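{- Let $\Sigma$ be a set, $\Sigma_\tau=\Sigma+\{\tau\}$. The monad $\mathcal{P}(\Sigma_\tau\times\mathcal{I}d)$ on $\mathsf{Set}$ described in the context is an ordered saturation monad, with saturation of $\alpha:X\to\mathcal{P}(\Sigma_\tau\times X)$ given by $(m_X\cdot\overline{\Sigma_\tau}\alpha)^*\cdot e_X$, where $\cdot$ is relational composition and $(-)^*$ is reflexive–transitive closure of a relation (as explained in the context).
   Context: Maps $X\to\mathcal{P}Y$ are identified with relations from $X$ to $Y$; $\cdot$ denotes their composition $g\cdot f(x)=\bigcup_{y\in f(x)}g(y)$, and for $\beta:Z\to\mathcal{P}Z$, $\beta^*$ is the reflexive–transitive closure, $\beta^*(z)=\bigcup_{n\ge0}\beta^n(z)$. The monad $\mathcal{P}(\Sigma_\tau\times\mathcal{I}d)$ has unit $x\mapsto\{(\tau,x)\}$ and Kleisli composition, for $f:X\to\mathcal{P}(\Sigma_\tau\times Y)$, $g:Y\to\mathcal{P}(\Sigma_\tau\times Z)$: $g\bullet f(x)=\{(\sigma,z)\mid\exists y:\ ((\sigma,y)\in f(x)\text{ and }(\tau,z)\in g(y))\text{ or }((\tau,y)\in f(x)\text{ and }(\sigma,z)\in g(y))\}$; Kleisli hom-sets are ordered pointwise by inclusion. For $\alpha:X\to\mathcal{P}(\Sigma_\tau\times X)$: $\overline{\Sigma_\tau}\alpha:\Sigma_\tau\times X\to\mathcal{P}(\Sigma_\tau\times\Sigma_\tau\times X)$, $(\sigma,x)\mapsto\{(\sigma,\sigma',x')\mid(\sigma',x')\in\alpha(x)\}$;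 $m_X:\Sigma_\tau\times\Sigma_\tau\times X\to\mathcal{P}(\Sigma_\tau\times X)$ sends $(\sigma_1,\tau,x)\mapsto\{(\sigma_1,x)\}$, $(\tau,\sigma_2,x)\mapsto\{(\sigma_2,x)\}$, and $(\sigma_1,\sigma_2,x)\mapsto\varnothing$ if $\sigma_1,\sigma_2\ne\tau$; $e_X(x)=\{(\tau,x)\}$. Ordered saturation monad (for a monad $M$ on $\mathsf{Set}$ with Kleisli composition $\bullet$, identities $1$, and $f^\sharp$ the Kleisli morphism induced by a map $f$, here $f^\sharp(x)=\{(\tau,f(x))\}$): Kleisli hom-sets are posets with monotone composition and for each $\alpha:X\rightsquigarrow X$ there is $\alpha^\star$ with (1) $1\le\alpha^\star$; (2) $\alpha\le\alpha^\star$; (3) $\alpha^\star\bullet\alpha^\star\le\alpha^\star$; (4) $\alpha^\star\le\beta$ whenever $1\le\beta$, $\alpha\le\beta$, $\beta\bullet\beta\le\beta$; (5) for every map $f:X\to Y$ and $\beta:Y\rightsquigarrow Y$, $f^\sharp\bullet\alpha\le\beta\bullet f^\sharp\Rightarrow f^\sharp\bullet\alpha^\star\le\beta^\star\bullet f^\sharp$, and likewise with $\ge$. -}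

module Defs where

open import Data.Maybe using (Maybe; just; nothing)
open import Data.Product using (Σ; ∃; _×_; _,_)
open import Data.Sum using (_⊎_)
open import Data.Empty using (⊥)
open import Relation.Binary.PropositionalEquality using (_≡_)
open import Relation.Binary.Construct.Closure.ReflexiveTransitive using (Star)

Στ : Set → Set
Στ S = Maybe S

τ : {S : Set} → Στ S
τ = nothing

𝒫 : Set → Set₁
𝒫 A = A → Set

Rel : Set → Set → Set₁
Rel X Y = X → 𝒫 Y

_·_ : {X Y Z : Set} → Rel Y Z → Rel X Y → Rel X Z
(g · f) x z = ∃ λ y → f x y × g y z

infixr 9 _·_

_^* : {Z : Set} → Rel Z Z → Rel Z Z
(β ^*) = Star β

KL : Set → Set → Set → Set₁
KL S X Y = X → 𝒫 (Στ S × Y)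

ηK : {S X : Set} → KL S X X
ηK x (σ , y) = (σ ≡ τ) × (y ≡ x)

_•_ : {S X Y Z : Set} → KL S Y Z → KL S X Y → KL S X Z
(g • f) x (σ , z) = ∃ λ y → ((f x (σ , y) × g y (τ , z)) ⊎ (f x (τ , y) × g y (σ , z)))

infixr 9 _•_

_≤K_ : {S X Y : Set} → KL S X Y → KL S X Y → Set
f ≤K g = ∀ x p → f x p → g x p

infix 4 _≤K_

_♯ : {S X Y : Set} → (X → Y) → KL S X Y
(f ♯) x (σ , y) = (σ ≡ τ) × (y ≡ f x)

Σ̄ : {S X : Set} → KL S X X → Rel (Στ S × X) (Στ S × Στ S × X)
Σ̄ α (σ , x) (σ₁ , σ' , x') = (σ₁ ≡ σ) × α x (σ' , x')

mX : {S X : Set} → Rel (Στ S × Στ S × X) (Στ S × X)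
mX (nothing , σ₂ , x) (σ , x') = (σ ≡ σ₂) × (x' ≡ x)
mX (just a , nothing , x) (σ , x') = (σ ≡ just a) × (x' ≡ x)
mX (just a , just b , x) _ = ⊥

eX : {S X : Set} → Rel X (Στ S × X)
eX x (σ , x') = (σ ≡ τ) × (x' ≡ x)

sat : {S X : Set} → KL S X X → KL S X X
sat α = ((mX · Σ̄ α) ^*) · eX

record IsOrderedSaturation (S : Set) (_⋆ : {X : Set} → KL S X X → KL S X X) : Set₁ where
  field
    •-mono : {X Y Z : Set} (f f' : KL S X Y) (g g' : KL S Y Z) →
             f ≤K f' → g ≤K g' → g • f ≤K g' • f'
    sat-1 : {X : Set} (α : KL S X X) → ηK ≤K (α ⋆)
    sat-2 : {X : Set} (α : KL S X X) → α ≤K (α ⋆)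
    sat-3 : {X : Set} (α : KL S X X) → (α ⋆) • (α ⋆) ≤K (α ⋆)
    sat-4 : {X : Set} (α β : KL S X X) →
            ηK ≤K β → α ≤K β → β • β ≤K β → (α ⋆) ≤K β
    sat-5≤ : {X Y : Set} (f : X → Y) (α : KL S X X) (β : KL S Y Y) →
             (f ♯) • α ≤K β • (f ♯) → (f ♯) • (α ⋆) ≤K (β ⋆) • (f ♯)
    sat-5≥ : {X Y : Set} (f : X → Y) (α : KL S X X) (β : KL S Y Y) →
             β • (f ♯) ≤K (f ♯) • α → (β ⋆) • (f ♯) ≤K (f ♯) • (α ⋆)

-- Read m_X · Σ̄ α as a step relation on Σ_τ × X: from (σ , u) it follows an α-transition
-- u → v labelled σ' and moves to (σ ⊕ σ' , v), where σ ⊕ σ' is defined only when one of the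
-- two labels is τ.  So sat α x (σ , y) says that some α-path from x to y carries at most one
-- visible label, namely σ.  A collected visible label persists, hence a silent path may be
-- relabelled by any σ, which gives transitivity; a •-transitive β ⊇ α absorbs the steps of
-- such a path one at a time, which gives minimality; and the lax naturality squares for f say
-- exactly that f maps α-transitions to β-transitions (resp. lifts β-transitions out of f u),
-- which transports paths step by step.
module Submission where

open import Defs
open import Data.Maybe using (just; nothing)
open import Data.Product using (∃; _×_; _,_)
open import Data.Sum using (_⊎_; inj₁; inj₂)
open import Relation.Binary.PropositionalEquality using (_≡_; refl)
open import Relation.Binary.Construct.Closure.ReflexiveTransitive using (ε; _◅_; _◅◅_; map)

module _ {S : Set} where

  private variable
    W X Y Z : Set
    σ σ' : Στ S

  •-mono : (f f' : KL S X Y) (g g' : KL S Y Z) → f ≤K f' → g ≤K g' → g • f ≤K g' • f'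
  •-mono f f' g g' f≤f' g≤g' x _ (y , inj₁ (fxy , gyz)) = y , inj₁ (f≤f' x _ fxy , g≤g' y _ gyz)
  •-mono f f' g g' f≤f' g≤g' x _ (y , inj₂ (fxy , gyz)) = y , inj₂ (f≤f' x _ fxy , g≤g' y _ gyz)

  Step : KL S X X → Rel (Στ S × X) (Στ S × X)
  Step α = mX · Σ̄ α

  Path : KL S X X → Rel (Στ S × X) (Στ S × X)
  Path α = Step α ^*

  module _ {X : Set} (α : KL S X X) where

    step-elim : {u v : X} →
                Step α (σ , u) (σ' , v) → (σ ≡ τ × α u (σ' , v)) ⊎ (σ' ≡ σ × α u (τ , v))
    step-elim {σ = nothing} (_ , (refl , a) , (refl , refl)) = inj₁ (refl , a)
    step-elim {σ = just _} ((_ , nothing , _) , (refl , a) , (refl , refl)) = inj₂ (refl , a)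
    step-elim {σ = just _} ((_ , just _ , _) , (refl , _) , ())

    step-intro : {u v : X} →
                 (σ ≡ τ × α u (σ' , v)) ⊎ (σ' ≡ σ × α u (τ , v)) → Step α (σ , u) (σ' , v)
    step-intro (inj₁ (refl , a)) = _ , (refl , a) , (refl , refl)
    step-intro {σ = nothing} (inj₂ (refl , a)) = _ , (refl , a) , (refl , refl)
    step-intro {σ = just _} (inj₂ (refl , a)) = _ , (refl , a) , (refl , refl)

    silent-step-elim : {u v : X} → Step α (τ , u) (σ , v) → α u (σ , v)
    silent-step-elim (_ , (refl , a) , (refl , refl)) = a

    sat-elim : {x : X} {q : Στ S × X} → sat α x q → Path α (τ , x) q
    sat-elim (_ , (refl , refl) , path) = path

    sat-intro : {x : X} {q : Στ S × X} → Path α (τ , x) q → sat α x q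
    sat-intro path = _ , (refl , refl) , path

    visible-label-persists : {c : S} {u v : X} → Path α (just c , u) (σ , v) → σ ≡ just c
    visible-label-persists ε = refl
    visible-label-persists (s ◅ rest) with step-elim s
    ... | inj₂ (refl , _) = visible-label-persists rest

    silent-path-relabel : {u v : X} → Path α (τ , u) (τ , v) → Path α (σ , u) (σ , v)
    silent-path-relabel ε = ε
    silent-path-relabel (_◅_ {j = nothing , _} s rest) =
      step-intro (inj₂ (refl , silent-step-elim s)) ◅ silent-path-relabel rest
    silent-path-relabel (_◅_ {j = just _ , _} s rest) with visible-label-persists rest
    ... | ()

    η≤sat : ηK ≤K sat α
    η≤sat x _ (refl , refl) = sat-intro ε

    α≤sat : α ≤K sat α
    α≤sat x _ a = sat-intro (step-intro (inj₁ (refl , a)) ◅ ε)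

    sat•sat≤sat : sat α • sat α ≤K sat α
    sat•sat≤sat x _ (y , inj₁ (xy , yz)) =
      sat-intro (sat-elim xy ◅◅ silent-path-relabel (sat-elim yz))
    sat•sat≤sat x _ (y , inj₂ (xy , yz)) = sat-intro (sat-elim xy ◅◅ sat-elim yz)

  module _ {X : Set} {α β : KL S X X} where

    Path-mono : α ≤K β → {p q : Στ S × X} → Path α p q → Path β p q
    Path-mono α≤β = map λ { (t , (refl , a) , m) → t , (refl , α≤β _ _ a) , m }

  module _ {X : Set} (β : KL S X X) (β•β≤β : β • β ≤K β) {x : X} where

    •-closed-absorbs-step : {u v : X} → β x (σ , u) → Step β (σ , u) (σ' , v) → β x (σ' , v)
    •-closed-absorbs-step {u = u} xu s with step-elim β s
    ... | inj₁ (refl , uv) = β•β≤β x _ (u , inj₂ (xu , uv))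
    ... | inj₂ (refl , uv) = β•β≤β x _ (u , inj₁ (xu , uv))

    •-closed-absorbs-path : {u v : X} → β x (σ , u) → Path β (σ , u) (σ' , v) → β x (σ' , v)
    •-closed-absorbs-path xu ε = xu
    •-closed-absorbs-path xu (_◅_ {j = _ , _} s rest) =
      •-closed-absorbs-path (•-closed-absorbs-step xu s) rest

  sat-least : {X : Set} (α β : KL S X X) → ηK ≤K β → α ≤K β → β • β ≤K β → sat α ≤K β
  sat-least α β η≤β α≤β β•β≤β x (σ , y) xy =
    •-closed-absorbs-path β β•β≤β (η≤β x _ (refl , refl)) (Path-mono α≤β (sat-elim α xy))

  module _ {X Y : Set} (f : X → Y) where

    ♯•-elim : {γ : KL S W X} {x : W} {y : Y} → ((f ♯) • γ) x (σ , y) → ∃ λ w → γ x (σ , w) × y ≡ f w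
    ♯•-elim (w , inj₁ (xw , (refl , y≡fw))) = w , xw , y≡fw
    ♯•-elim (w , inj₂ (xw , (refl , y≡fw))) = w , xw , y≡fw

    ♯•-intro : {γ : KL S W X} {x : W} {w : X} → γ x (σ , w) → ((f ♯) • γ) x (σ , f w)
    ♯•-intro xw = _ , inj₁ (xw , (refl , refl))

    •♯-elim : {γ : KL S Y Z} {x : X} {q : Στ S × Z} → (γ • (f ♯)) x q → γ (f x) q
    •♯-elim (_ , inj₁ ((refl , refl) , fxq)) = fxq
    •♯-elim (_ , inj₂ ((refl , refl) , fxq)) = fxq

    •♯-intro : {γ : KL S Y Z} {x : X} {q : Στ S × Z} → γ (f x) q → (γ • (f ♯)) x q
    •♯-intro fxq = _ , inj₂ ((refl , refl) , fxq)

  Simulates : (X → Y) → KL S X X → KL S Y Y → Set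
  Simulates f α β = ∀ {u σ v} → α u (σ , v) → β (f u) (σ , f v)

  Lifts : (X → Y) → KL S X X → KL S Y Y → Set
  Lifts f α β = ∀ {u σ y} → β (f u) (σ , y) → ∃ λ w → α u (σ , w) × y ≡ f w

  module _ {X Y : Set} (f : X → Y) (α : KL S X X) (β : KL S Y Y) where

    ♯-lax-≤⇒Simulates : (f ♯) • α ≤K β • (f ♯) → Simulates f α β
    ♯-lax-≤⇒Simulates fα≤βf uv = •♯-elim f {γ = β} (fα≤βf _ _ (♯•-intro f {γ = α} uv))

    ♯-lax-≥⇒Lifts : β • (f ♯) ≤K (f ♯) • α → Lifts f α β
    ♯-lax-≥⇒Lifts βf≤fα fuy = ♯•-elim f {γ = α} (βf≤fα _ _ (•♯-intro f {γ = β} fuy))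

    Step-map : Simulates f α β → {u v : X} → Step α (σ , u) (σ' , v) → Step β (σ , f u) (σ' , f v)
    Step-map sim s with step-elim α s
    ... | inj₁ (refl , uv) = step-intro β (inj₁ (refl , sim uv))
    ... | inj₂ (refl , uv) = step-intro β (inj₂ (refl , sim uv))

    Path-map : Simulates f α β → {u v : X} → Path α (σ , u) (σ' , v) → Path β (σ , f u) (σ' , f v)
    Path-map sim ε = ε
    Path-map sim (_◅_ {j = _ , _} s rest) = Step-map sim s ◅ Path-map sim rest

    Step-lift : Lifts f α β → {u : X} {y : Y} →
                Step β (σ , f u) (σ' , y) → ∃ λ w → Step α (σ , u) (σ' , w) × y ≡ f w
    Step-lift lift s with step-elim β s
    ... | inj₁ (refl , fuy) with lift fuy
    ...   | w , uw , y≡fw = w , step-intro α (inj₁ (refl , uw)) , y≡fw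
    Step-lift lift s | inj₂ (refl , fuy) with lift fuy
    ...   | w , uw , y≡fw = w , step-intro α (inj₂ (refl , uw)) , y≡fw

    Path-lift : Lifts f α β → {u : X} {y : Y} →
                Path β (σ , f u) (σ' , y) → ∃ λ w → Path α (σ , u) (σ' , w) × y ≡ f w
    Path-lift lift ε = _ , ε , refl
    Path-lift lift (_◅_ {j = _ , _} s rest) with Step-lift lift s
    ... | w , s′ , refl with Path-lift lift rest
    ...   | v , rest′ , y≡fv = v , s′ ◅ rest′ , y≡fv

    sat-♯-≤ : (f ♯) • α ≤K β • (f ♯) → (f ♯) • sat α ≤K sat β • (f ♯)
    sat-♯-≤ fα≤βf x (σ , y) fαxy with ♯•-elim f {γ = sat α} fαxy
    ... | w , xw , refl =
      •♯-intro f {γ = sat β} (sat-intro β (Path-map (♯-lax-≤⇒Simulates fα≤βf) (sat-elim α xw)))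

    sat-♯-≥ : β • (f ♯) ≤K (f ♯) • α → sat β • (f ♯) ≤K (f ♯) • sat α
    sat-♯-≥ βf≤fα x (σ , y) βfxy
      with Path-lift (♯-lax-≥⇒Lifts βf≤fα) (sat-elim β (•♯-elim f {γ = sat β} βfxy))
    ... | w , xw , refl = ♯•-intro f {γ = sat α} (sat-intro α xw)

theorem5p11 : (S : Set) → IsOrderedSaturation S sat
theorem5p11 S = record
  { •-mono = •-mono
  ; sat-1 = η≤sat
  ; sat-2 = α≤sat
  ; sat-3 = sat•sat≤sat
  ; sat-4 = sat-least
  ; sat-5≤ = sat-♯-≤
  ; sat-5≥ = sat-♯-≥
  }
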